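{- Let $x,y,z$ be positive integers. Every permutation of the sequence $(x,x)$, every permutation of the sequence $(x,x,y,y)$, and every permutation of the sequence $(x,x,y,y,z,z)$ is a forbidden pattern.
   Context: For a finite set $S$ of positive integers, the skip graph $G(S)$ has vertex set $\mathbb{N}=\{0,1,2,\dots\}$ and, for each $s\in S$ and $j\ge0$, an edge (an $s$-arc) between $2js$ and $(2j+1)s$. An unsigned pattern $[a_1\dots a_n]$ is realizable if there exist signs $\epsilon_k\in\{\pm1\}$ and an integer $T\ge0$ such that with $T_0=T$, $T_k=T_{k-1}+\epsilon_ka_k$, each $T_{k-1}$ is an even multiple of $a_k$ (0 included) when $\epsilon_k=+1$ and an odd multiple of $a_k$ when $\epsilon_k=-1$, and $T_0,\dots,T_n$ are pairwise distinct; equivalently some path with distinct vertices in some skip graph has consecutive edges that are arcs of sizes $a_1,\dots,a_n$. A pattern that is not realizable is forbidden. -}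

module Defs where

open import Data.Nat using (ℕ; _+_; _*_)
open import Data.List using (List; []; _∷_)
open import Data.Product using (∃; ∃-syntax; _×_)
open import Data.List.Relation.Unary.Unique.Propositional using (Unique)
open import Relation.Binary.PropositionalEquality using (_≡_)

data Sign : Set where
  plus minus : Sign

data Step (a : ℕ) : Sign → ℕ → ℕ → Set where
  step+ : ∀ j → Step a plus (2 * j * a) (2 * j * a + a)
  step- : ∀ j → Step a minus ((2 * j + 1) * a) (2 * j * a)

-- Walk t as vs : starting at T_0 = t, following the pattern as with some signs,
-- visiting the vertices vs = (T_0, T_1, ..., T_n).
data Walk : ℕ → List ℕ → List ℕ → Set where
  done : ∀ t → Walk t [] (t ∷ [])
  next : ∀ {a t t' as vs} (ε : Sign) → Step a ε t t' →
         Walk t' as vs → Walk t (a ∷ as) (t ∷ vs)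

Realizable : List ℕ → Set
Realizable as = ∃[ t ] ∃[ vs ] (Walk t as vs × Unique vs)

module Submission where

-- Every vertex has exactly one a-arc for each a, so an arc size repeated immediately forces
-- backtracking; and in consecutive arcs s, t, s both ends of the t-arc are multiples of s, so
-- s ∣ t. This rules out aa and abab. The other arrangements of xxyyzz contain a frame s t u s
-- with t, u ≤ s or a nest s t u t s with t ≤ u < s, the bounds coming from such divisibilities.
-- In both, the ends of the middle stretch are distinct multiples of s that lie too close
-- together unless all middle arcs point the same way; then, barring backtracking, each middle
-- vertex is an even multiple of one arc size and an odd multiple of the next, and these
-- relations close a cycle along which the 2-adic valuation strictly increases.
-- Which configuration occurs is found by enumerating the permutations of a symbolic word.

open import Defs
open import Data.Empty using (⊥)
open import Data.Fin using (Fin; zero; suc)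
import Data.Fin.Properties as Fin
open import Data.List using (List; []; _∷_; _++_; map; concatMap; take; length)
open import Data.List.Membership.Propositional using (_∈_)
open import Data.List.Membership.Propositional.Properties using (∈-∃++; ∈-map⁺; ∈-concat⁺′)
open import Data.List.Relation.Binary.Infix.Heterogeneous using (Infix; here; there; MkView; toView)
import Data.List.Relation.Binary.Infix.Heterogeneous as Infix
import Data.List.Relation.Binary.Infix.Heterogeneous.Properties as Infix
open import Data.List.Relation.Binary.Permutation.Propositional using (_↭_; ↭-sym)
open import Data.List.Relation.Binary.Permutation.Propositional.Properties
  using (∈-resp-↭; ↭-empty-inv; drop-mid; ↭-map-inv)
open import Data.List.Relation.Binary.Pointwise using (Pointwise-≡⇒≡)
open import Data.List.Relation.Binary.Prefix.Heterogeneous.Properties using (prefix?)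
open import Data.List.Relation.Unary.All using (All; []; _∷_)
import Data.List.Relation.Unary.All as All
open import Data.List.Relation.Unary.AllPairs using ([]; _∷_)
open import Data.List.Relation.Unary.Any using (here; there)
import Data.List.Relation.Unary.Unique.Propositional.Properties as Unique
open import Data.Maybe using (Maybe; just; nothing; _<∣>_; from-just; From-just)
import Data.Maybe as Maybe
open import Data.Nat using (ℕ; zero; suc; _+_; _*_; _^_; _≤_; _<_; _>_; z≤n; s≤s; >-nonZero)
open import Data.Nat.Divisibility
  using (_∣_; divides; ∣⇒≤; >⇒∤; ∣-antisym; ∣-trans; ∣m+n∣m⇒∣n; n∣m*n; m∣m*n; *-monoʳ-∣; *-cancelˡ-∣; 1∣_)
open import Data.Nat.Primality using (prime[2]; euclidsLemma)
open import Data.Nat.Properties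
open import Algebra.Properties.CommutativeSemigroup +-commutativeSemigroup using (xy∙z≈xz∙y)
open import Data.Product using (_×_; _,_; -,_; ∃; ∃-syntax; proj₁; map₂)
open import Data.Sum using (_⊎_; inj₁; inj₂; [_,_])
open import Function using (_∘_)
open import Relation.Binary.Definitions using (DecidableEquality)
open import Relation.Binary.PropositionalEquality
  using (_≡_; _≢_; refl; sym; trans; cong; subst; subst₂; ≢-sym; module ≡-Reasoning)
open import Relation.Nullary using (¬_; contradiction; yes; no)
EvenMultiple OddMultiple : ℕ → ℕ → Set
EvenMultiple a t = ∃[ j ] t ≡ 2 * j * a
OddMultiple  a t = ∃[ j ] t ≡ 2 * j * a + a

Up : ℕ → ℕ → ℕ → Set
Up a t t′ = EvenMultiple a t × t′ ≡ t + a

Arc : ℕ → ℕ → ℕ → Set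
Arc a t t′ = Up a t t′ ⊎ Up a t′ t

arc-sym : ∀ {a t t′} → Arc a t t′ → Arc a t′ t
arc-sym (inj₁ up) = inj₂ up
arc-sym (inj₂ up) = inj₁ up

step⇒arc : ∀ {a ε t t′} → Step a ε t t′ → Arc a t t′
step⇒arc     (step+ j) = inj₁ ((j , refl) , refl)
step⇒arc {a} (step- j) = inj₂ ((j , refl) , trans (*-distribʳ-+ a (2 * j) 1) (cong (2 * j * a +_) (*-identityˡ a)))

up⇒oddMultiple : ∀ {a t t′} → Up a t t′ → OddMultiple a t′
up⇒oddMultiple ((j , refl) , refl) = j , refl

evenMultiple⇒¬oddMultiple : ∀ {a t} → 0 < a → EvenMultiple a t → ¬ OddMultiple a t
evenMultiple⇒¬oddMultiple {a} a>0 (j , refl) (k , 2ja≡2ka+a) =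
  even≢odd j k (*-cancelʳ-≡ _ _ a {{>-nonZero a>0}} (trans 2ja≡2ka+a (+-comm (2 * k * a) a)))

up⇒∣ˡ : ∀ {a t t′} → Up a t t′ → a ∣ t
up⇒∣ˡ ((j , t≡2ja) , _) = divides (2 * j) t≡2ja

up⇒∣ʳ : ∀ {a t t′} → Up a t t′ → a ∣ t′
up⇒∣ʳ {a} ((j , refl) , refl) = divides (suc (2 * j)) (+-comm (2 * j * a) a)

arc⇒∣ˡ : ∀ {a t t′} → Arc a t t′ → a ∣ t
arc⇒∣ˡ (inj₁ up) = up⇒∣ˡ up
arc⇒∣ˡ (inj₂ up) = up⇒∣ʳ up

arc⇒∣ʳ : ∀ {a t t′} → Arc a t t′ → a ∣ t′
arc⇒∣ʳ = arc⇒∣ˡ ∘ arc-sym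

-- Whether t₁ is an even or an odd multiple of a decides on which side its unique a-arc lies.
arc-backtrack : ∀ {a t₀ t₁ t₂} → 0 < a → Arc a t₀ t₁ → Arc a t₁ t₂ → t₀ ≡ t₂
arc-backtrack a>0 (inj₁ up₀₁) (inj₁ (ev₁ , _)) = contradiction (up⇒oddMultiple up₀₁) (evenMultiple⇒¬oddMultiple a>0 ev₁)
arc-backtrack {a} _ (inj₁ (_ , refl)) (inj₂ (_ , t₁≡t₂+a)) = +-cancelʳ-≡ a _ _ t₁≡t₂+a
arc-backtrack _ (inj₂ (_ , t₀≡t₁+a)) (inj₁ (_ , t₂≡t₁+a)) = trans t₀≡t₁+a (sym t₂≡t₁+a)
arc-backtrack a>0 (inj₂ (ev₁ , _)) (inj₂ up₂₁) = contradiction (up⇒oddMultiple up₂₁) (evenMultiple⇒¬oddMultiple a>0 ev₁)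

_≺_ : ℕ → ℕ → Set
t ≺ s = ∃[ v ] EvenMultiple t v × OddMultiple s v

2∤odd : ∀ i → ¬ 2 ∣ suc (2 * i)
2∤odd i (divides q 1+2i≡2q) = even≢odd q i (sym (trans 1+2i≡2q (*-comm q 2)))

2^k∣odd*n⇒2^k∣n : ∀ k i n → 2 ^ k ∣ suc (2 * i) * n → 2 ^ k ∣ n
2^k∣odd*n⇒2^k∣n zero    i n _ = 1∣ n
2^k∣odd*n⇒2^k∣n (suc k) i n 2^1+k∣odd*n
  with euclidsLemma (suc (2 * i)) n prime[2] (∣-trans (m∣m*n (2 ^ k)) 2^1+k∣odd*n)
... | inj₁ 2∣odd = contradiction 2∣odd (2∤odd i)
... | inj₂ (divides q refl) = subst (2 ^ suc k ∣_) (*-comm 2 q) (*-monoʳ-∣ 2 2^k∣q)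
  where
  odd*2q≡2*odd*q : suc (2 * i) * (q * 2) ≡ 2 * (suc (2 * i) * q)
  odd*2q≡2*odd*q = trans (sym (*-assoc (suc (2 * i)) q 2)) (*-comm (suc (2 * i) * q) 2)
  2^k∣q : 2 ^ k ∣ q
  2^k∣q = 2^k∣odd*n⇒2^k∣n k i q (*-cancelˡ-∣ 2 (subst (2 ^ suc k ∣_) odd*2q≡2*odd*q 2^1+k∣odd*n))

≺⇒2^k∣⇒2^1+k∣ : ∀ {t s} k → t ≺ s → 2 ^ k ∣ t → 2 ^ suc k ∣ s
≺⇒2^k∣⇒2^1+k∣ {t} {s} k (v , (j , v≡2jt) , (i , v≡2is+s)) 2^k∣t =
  2^k∣odd*n⇒2^k∣n (suc k) i s (subst (2 ^ suc k ∣_) 2jt≡odd*s (*-monoʳ-∣ 2 (∣-trans 2^k∣t (n∣m*n j))))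
  where
  2jt≡odd*s : 2 * (j * t) ≡ suc (2 * i) * s
  2jt≡odd*s = begin
    2 * (j * t)       ≡⟨ *-assoc 2 j t ⟨
    2 * j * t         ≡⟨ v≡2jt ⟨
    v                 ≡⟨ v≡2is+s ⟩
    2 * i * s + s     ≡⟨ +-comm (2 * i * s) s ⟩
    suc (2 * i) * s   ∎
    where open ≡-Reasoning

n<2^n : ∀ n → n < 2 ^ n
n<2^n zero    = s≤s z≤n
n<2^n (suc n) = +-mono-≤-< (m^n>0 2 n) (≤-trans (n<2^n n) (m≤m+n (2 ^ n) 0))

¬2-self-raising : ∀ {a} → 0 < a → ¬ (∀ k → 2 ^ k ∣ a → 2 ^ suc k ∣ a)
¬2-self-raising {a} a>0 raise = >⇒∤ {{>-nonZero a>0}} (n<2^n a) (all-powers a)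
  where
  all-powers : ∀ k → 2 ^ k ∣ a
  all-powers zero    = 1∣ a
  all-powers (suc k) = raise k (all-powers k)

2^1+k∣⇒2^k∣ : ∀ {n} k → 2 ^ suc k ∣ n → 2 ^ k ∣ n
2^1+k∣⇒2^k∣ k = ∣-trans (n∣m*n 2)

≺-acyclic₂ : ∀ {a b} → 0 < a → a ≺ b → b ≺ a → ⊥
≺-acyclic₂ a>0 a≺b b≺a = ¬2-self-raising a>0 λ k →
  2^1+k∣⇒2^k∣ (suc k) ∘ ≺⇒2^k∣⇒2^1+k∣ (suc k) b≺a ∘ ≺⇒2^k∣⇒2^1+k∣ k a≺b

≺-acyclic₃ : ∀ {a b c} → 0 < a → a ≺ b → b ≺ c → c ≺ a → ⊥
≺-acyclic₃ a>0 a≺b b≺c c≺a = ¬2-self-raising a>0 λ k →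
  2^1+k∣⇒2^k∣ (suc k) ∘ 2^1+k∣⇒2^k∣ (suc (suc k)) ∘
  ≺⇒2^k∣⇒2^1+k∣ (suc (suc k)) c≺a ∘ ≺⇒2^k∣⇒2^1+k∣ (suc k) b≺c ∘ ≺⇒2^k∣⇒2^1+k∣ k a≺b

∣∧<⇒≡0 : ∀ {s d} → s ∣ d → d < s → d ≡ 0
∣∧<⇒≡0 {d = zero}  _   _   = refl
∣∧<⇒≡0 {d = suc d} s∣d d<s = contradiction s∣d (>⇒∤ d<s)

∣∧0<n<s+s⇒n≡s : ∀ {s n} → s ∣ n → 0 < n → n < s + s → n ≡ s
∣∧0<n<s+s⇒n≡s (divides zero          refl)  ()
∣∧0<n<s+s⇒n≡s (divides (suc zero)    refl)  _   _       = +-identityʳ _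
∣∧0<n<s+s⇒n≡s {s} (divides (suc (suc q)) refl) _ n<s+s =
  contradiction (+-monoʳ-≤ s (m≤m+n s (q * s))) (<⇒≱ n<s+s)

∣-close⇒≡ˡ : ∀ {s a b p q} → s ∣ a → s ∣ b → a ≤ b → a + p ≡ b + q → p < q + s → a ≡ b
∣-close⇒≡ˡ {s} {a} {p = p} {q} s∣a s∣b a≤b a+p≡b+q p<q+s with m≤n⇒∃[o]m+o≡n a≤b
... | d , refl = sym (trans (cong (a +_) d≡0) (+-identityʳ a))
  where
  p≡d+q : p ≡ d + q
  p≡d+q = +-cancelˡ-≡ a p (d + q) (trans a+p≡b+q (+-assoc a d q))
  d≡0 : d ≡ 0
  d≡0 = ∣∧<⇒≡0 (∣m+n∣m⇒∣n s∣b s∣a) (+-cancelʳ-< q d s (subst₂ _<_ p≡d+q (+-comm q s) p<q+s))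

∣-close⇒≡ : ∀ {s a b p q} → s ∣ a → s ∣ b → a + p ≡ b + q → p < q + s → q < p + s → a ≡ b
∣-close⇒≡ {a = a} {b} s∣a s∣b a+p≡b+q p<q+s q<p+s with ≤-total a b
... | inj₁ a≤b = ∣-close⇒≡ˡ s∣a s∣b a≤b a+p≡b+q p<q+s
... | inj₂ b≤a = sym (∣-close⇒≡ˡ s∣b s∣a b≤a (sym a+p≡b+q) q<p+s)

realizable-++⁻ʳ : ∀ u {p} → Realizable (u ++ p) → Realizable p
realizable-++⁻ʳ []      r                                     = r
realizable-++⁻ʳ (_ ∷ u) (_ , _ , next _ _ walk , _ ∷ distinct) = realizable-++⁻ʳ u (_ , _ , walk , distinct)

walk-++⁻ˡ : ∀ p {v t vs} → Walk t (p ++ v) vs → Walk t p (take (suc (length p)) vs)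
walk-++⁻ˡ []      (done t)          = done t
walk-++⁻ˡ []      (next _ _ _)      = done _
walk-++⁻ˡ (_ ∷ p) (next ε step walk) = next ε step (walk-++⁻ˡ p walk)

realizable-++⁻ˡ : ∀ p {v} → Realizable (p ++ v) → Realizable p
realizable-++⁻ˡ p (t , vs , walk , distinct) = t , _ , walk-++⁻ˡ p walk , Unique.take⁺ (suc (length p)) distinct

realizable-factor : ∀ u q {v} → Realizable (u ++ q ++ v) → Realizable q
realizable-factor u q = realizable-++⁻ˡ q ∘ realizable-++⁻ʳ u

realizable-infix : ∀ {q p} → Infix _≡_ q p → Realizable p → Realizable q
realizable-infix q⊆p with toView q⊆p
... | MkView u q≋q′ v rewrite Pointwise-≡⇒≡ q≋q′ = realizable-factor u _

stutter-unrealizable : ∀ {a} → 0 < a → ¬ Realizable (a ∷ a ∷ [])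
stutter-unrealizable a>0 (_ , _ , next _ α (next _ β (done _)) , (_ ∷ t₀≢t₂ ∷ []) ∷ _) =
  t₀≢t₂ (arc-backtrack a>0 (step⇒arc α) (step⇒arc β))

sandwich⇒∣ : ∀ {s u} → Realizable (s ∷ u ∷ s ∷ []) → s ∣ u
sandwich⇒∣ (_ , _ , next _ α (next _ β (next _ γ (done _))) , _) with step⇒arc β
... | inj₁ (_ , refl) = ∣m+n∣m⇒∣n (arc⇒∣ˡ (step⇒arc γ)) (arc⇒∣ʳ (step⇒arc α))
... | inj₂ (_ , refl) = ∣m+n∣m⇒∣n (arc⇒∣ʳ (step⇒arc α)) (arc⇒∣ˡ (step⇒arc γ))

square-unrealizable : ∀ {a b} → 0 < a → ¬ Realizable (a ∷ b ∷ a ∷ b ∷ [])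
square-unrealizable a>0 r
  with ∣-antisym (sandwich⇒∣ (realizable-factor [] (_ ∷ _ ∷ _ ∷ []) r))
                 (sandwich⇒∣ (realizable-factor (_ ∷ []) (_ ∷ _ ∷ _ ∷ []) r))
... | refl = stutter-unrealizable a>0 (realizable-factor [] (_ ∷ _ ∷ []) r)

∣t+u⇒t≡s⊎t+u≡s : ∀ {s t u} → s ∣ t + u → 0 < t → t ≤ s → u ≤ s → t ≡ s ⊎ t + u ≡ s
∣t+u⇒t≡s⊎t+u≡s {t = t} {u} s∣t+u t>0 t≤s u≤s with m≤n⇒m<n∨m≡n t≤s
... | inj₂ t≡s = inj₁ t≡s
... | inj₁ t<s = inj₂ (∣∧0<n<s+s⇒n≡s s∣t+u (≤-trans t>0 (m≤m+n t u)) (+-mono-<-≤ t<s u≤s))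

-- Both middle arcs go up, so t₃ = t₁ + t + u is a multiple of s above t₁: t + u = s, and
-- then the outer arcs either backtrack onto the path or close a ≺-cycle s ≺ u ≺ t ≺ s.
ascending-frame : ∀ {s t u t₀ t₁ t₂ t₃ t₄} → 0 < t → t ≤ s → u ≤ s →
                  Arc s t₀ t₁ → Up t t₁ t₂ → Up u t₂ t₃ → Arc s t₃ t₄ →
                  t₀ ≢ t₂ → t₀ ≢ t₃ → t₁ ≢ t₄ → ⊥
ascending-frame {s} {t} {u} {t₀} {t₁} {t₄ = t₄} t>0 t≤s u≤s α β@(_ , refl) γ@(_ , refl) δ t₀≢t₂ t₀≢t₃ t₁≢t₄
  with ∣t+u⇒t≡s⊎t+u≡s (∣m+n∣m⇒∣n (subst (s ∣_) (+-assoc t₁ t u) (arc⇒∣ˡ δ)) (arc⇒∣ʳ α)) t>0 t≤s u≤s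
... | inj₁ refl = t₀≢t₂ (arc-backtrack t>0 α (inj₁ β))
... | inj₂ refl = outer-arcs α δ
  where
  outer-arcs : Arc (t + u) t₀ t₁ → Arc (t + u) (t₁ + t + u) t₄ → ⊥
  outer-arcs (inj₂ (_ , t₀≡t₁+s)) _ = t₀≢t₃ (trans t₀≡t₁+s (sym (+-assoc t₁ t u)))
  outer-arcs _ (inj₂ (_ , t₃≡t₄+s)) = t₁≢t₄ (+-cancelʳ-≡ (t + u) t₁ _ (trans (sym (+-assoc t₁ t u)) t₃≡t₄+s))
  outer-arcs (inj₁ α↑) (inj₁ δ↑) =
    ≺-acyclic₃ (≤-trans t>0 (m≤m+n t u)) (_ , proj₁ δ↑ , up⇒oddMultiple γ) (_ , proj₁ γ , up⇒oddMultiple β) (_ , proj₁ β , up⇒oddMultiple α↑)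

frame-unrealizable : ∀ {s t u} → 0 < t → 0 < u → t ≤ s → u ≤ s → ¬ Realizable (s ∷ t ∷ u ∷ s ∷ [])
frame-unrealizable {s} {t} {u} t>0 u>0 t≤s u≤s
  (_ , _ , next _ α (next _ β (next _ γ (next _ δ (done _)))) ,
   (_ ∷ t₀≢t₂ ∷ t₀≢t₃ ∷ _ ∷ []) ∷ (_ ∷ t₁≢t₃ ∷ t₁≢t₄ ∷ []) ∷ (_ ∷ t₂≢t₄ ∷ []) ∷ _)
  with step⇒arc β | step⇒arc γ
... | inj₁ β↑ | inj₁ γ↑ =
  ascending-frame t>0 t≤s u≤s (step⇒arc α) β↑ γ↑ (step⇒arc δ) t₀≢t₂ t₀≢t₃ t₁≢t₄
... | inj₂ β↓ | inj₂ γ↓ =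
  ascending-frame u>0 u≤s t≤s (arc-sym (step⇒arc δ)) γ↓ β↓ (arc-sym (step⇒arc α))
                  (≢-sym t₂≢t₄) (≢-sym t₁≢t₄) (≢-sym t₀≢t₃)
... | inj₁ (_ , refl) | inj₂ (_ , t₁+t≡t₃+u) =
  t₁≢t₃ (∣-close⇒≡ (arc⇒∣ʳ (step⇒arc α)) (arc⇒∣ˡ (step⇒arc δ)) t₁+t≡t₃+u
                    (≤-<-trans t≤s (m<n+m s u>0)) (≤-<-trans u≤s (m<n+m s t>0)))
... | inj₂ (_ , refl) | inj₁ (_ , refl) =
  t₁≢t₃ (∣-close⇒≡ (arc⇒∣ʳ (step⇒arc α)) (arc⇒∣ˡ (step⇒arc δ)) (xy∙z≈xz∙y _ t u)
                    (≤-<-trans u≤s (m<n+m s t>0)) (≤-<-trans t≤s (m<n+m s u>0)))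

nested-core : ∀ {s t u t₀ t₁ t₂ t₃ t₄ t₅} → 0 < t → t ≤ u → u < s → t₁ ≢ t₄ →
              Arc s t₀ t₁ → Arc t t₁ t₂ → Up u t₂ t₃ → Arc t t₃ t₄ → Arc s t₄ t₅ → ⊥
nested-core {s} {t} {u} {t₁ = t₁} {t₂} {t₄ = t₄} t>0 t≤u u<s t₁≢t₄ α β γ@(_ , refl) δ ε = middle β δ
  where
  u>0 : 0 < u
  u>0 = ≤-trans t>0 t≤u
  close : ∀ {p q} → t₁ + p ≡ t₄ + q → p < q + s → q < p + s → ⊥
  close t₁+p≡t₄+q p<q+s q<p+s = t₁≢t₄ (∣-close⇒≡ (arc⇒∣ʳ α) (arc⇒∣ˡ ε) t₁+p≡t₄+q p<q+s q<p+s)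
  u-apart : t₁ + u ≡ t₄ → ⊥
  u-apart t₁+u≡t₄ = close (trans t₁+u≡t₄ (sym (+-identityʳ t₄))) u<s (≤-trans u>0 (m≤m+n u s))
  middle : Arc t t₁ t₂ → Arc t (t₂ + u) t₄ → ⊥
  middle (inj₁ β↑) (inj₁ δ↑) =
    ≺-acyclic₂ u>0 (_ , proj₁ γ , up⇒oddMultiple β↑) (_ , proj₁ δ↑ , up⇒oddMultiple γ)
  middle (inj₁ (_ , refl)) (inj₂ (_ , t₃≡t₄+t)) =
    u-apart (+-cancelʳ-≡ t _ t₄ (trans (xy∙z≈xz∙y t₁ u t) t₃≡t₄+t))
  middle (inj₂ (_ , refl)) (inj₁ (_ , refl)) = u-apart (xy∙z≈xz∙y t₂ t u)
  middle (inj₂ (_ , refl)) (inj₂ (_ , t₃≡t₄+t)) =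
    close (trans (xy∙z≈xz∙y t₂ t u) (trans (cong (_+ t) t₃≡t₄+t) (+-assoc t₄ t t)))
          (<-≤-trans u<s (m≤n+m s (t + t))) (+-mono-≤-< t≤u (≤-<-trans t≤u u<s))

-- Reversing the path if necessary, the middle u-arc goes up.
nested-unrealizable : ∀ {s t u} → 0 < t → t ≤ u → u < s → ¬ Realizable (s ∷ t ∷ u ∷ t ∷ s ∷ [])
nested-unrealizable t>0 t≤u u<s
  (_ , _ , next _ α (next _ β (next _ γ (next _ δ (next _ ε (done _))))) , _ ∷ (_ ∷ _ ∷ t₁≢t₄ ∷ _) ∷ _)
  with step⇒arc γ
... | inj₁ γ↑ =
  nested-core t>0 t≤u u<s t₁≢t₄ (step⇒arc α) (step⇒arc β) γ↑ (step⇒arc δ) (step⇒arc ε)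
... | inj₂ γ↓ =
  nested-core t>0 t≤u u<s (≢-sym t₁≢t₄)
              (arc-sym (step⇒arc ε)) (arc-sym (step⇒arc δ)) γ↓ (arc-sym (step⇒arc β)) (arc-sym (step⇒arc α))

sandwich⇒≤ : ∀ {s u} → 0 < u → Realizable (s ∷ u ∷ s ∷ []) → s ≤ u
sandwich⇒≤ u>0 = ∣⇒≤ {{>-nonZero u>0}} ∘ sandwich⇒∣

abacbc-unrealizable : ∀ {x y z} → 0 < x → 0 < y → 0 < z → ¬ Realizable (x ∷ y ∷ x ∷ z ∷ y ∷ z ∷ [])
abacbc-unrealizable x>0 y>0 z>0 r =
  frame-unrealizable x>0 z>0 (sandwich⇒≤ y>0 (realizable-factor [] (_ ∷ _ ∷ _ ∷ []) r))
                             (sandwich⇒≤ y>0 (realizable-factor (_ ∷ _ ∷ _ ∷ []) (_ ∷ _ ∷ _ ∷ []) r))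
                             (realizable-factor (_ ∷ []) (_ ∷ _ ∷ _ ∷ _ ∷ []) r)

abcacb-unrealizable : ∀ {x y z} → 0 < x → 0 < y → 0 < z → ¬ Realizable (x ∷ y ∷ z ∷ x ∷ z ∷ y ∷ [])
abcacb-unrealizable {x} {y} {z} x>0 y>0 z>0 r = [ x-outermost , y-outermost ] (≤-<-connex y x)
  where
  z≤x : z ≤ x
  z≤x = sandwich⇒≤ x>0 (realizable-factor (_ ∷ _ ∷ []) (_ ∷ _ ∷ _ ∷ []) r)
  x-outermost : y ≤ x → ⊥
  x-outermost y≤x = frame-unrealizable y>0 z>0 y≤x z≤x (realizable-factor [] (_ ∷ _ ∷ _ ∷ _ ∷ []) r)
  y-outermost : x < y → ⊥
  y-outermost x<y = nested-unrealizable z>0 z≤x x<y (realizable-factor (_ ∷ []) (_ ∷ _ ∷ _ ∷ _ ∷ _ ∷ []) r)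

abcbac-unrealizable : ∀ {x y z} → 0 < x → 0 < y → 0 < z → ¬ Realizable (x ∷ y ∷ z ∷ y ∷ x ∷ z ∷ [])
abcbac-unrealizable {x} {y} {z} x>0 y>0 z>0 r = [ z-outermost , x-outermost ] (≤-<-connex x z)
  where
  y≤z : y ≤ z
  y≤z = sandwich⇒≤ z>0 (realizable-factor (_ ∷ []) (_ ∷ _ ∷ _ ∷ []) r)
  z-outermost : x ≤ z → ⊥
  z-outermost x≤z = frame-unrealizable y>0 x>0 y≤z x≤z (realizable-factor (_ ∷ _ ∷ []) (_ ∷ _ ∷ _ ∷ _ ∷ []) r)
  x-outermost : z < x → ⊥
  x-outermost z<x = nested-unrealizable y>0 y≤z z<x (realizable-factor [] (_ ∷ _ ∷ _ ∷ _ ∷ _ ∷ []) r)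

abcabc-unrealizable : ∀ {x y z} → 0 < x → 0 < y → 0 < z → ¬ Realizable (x ∷ y ∷ z ∷ x ∷ y ∷ z ∷ [])
abcabc-unrealizable {x} {y} {z} x>0 y>0 z>0 r with ≤-total y x | ≤-total x z | ≤-total z y
... | inj₁ y≤x | inj₂ z≤x | _ =
  frame-unrealizable y>0 z>0 y≤x z≤x (realizable-factor [] (_ ∷ _ ∷ _ ∷ _ ∷ []) r)
... | inj₂ x≤y | _ | inj₁ z≤y =
  frame-unrealizable z>0 x>0 z≤y x≤y (realizable-factor (_ ∷ []) (_ ∷ _ ∷ _ ∷ _ ∷ []) r)
... | inj₁ y≤x | inj₁ x≤z | _ =
  frame-unrealizable x>0 y>0 x≤z (≤-trans y≤x x≤z) (realizable-factor (_ ∷ _ ∷ []) (_ ∷ _ ∷ _ ∷ _ ∷ []) r)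
... | inj₂ x≤y | _ | inj₂ y≤z =
  frame-unrealizable x>0 y>0 (≤-trans x≤y y≤z) y≤z (realizable-factor (_ ∷ _ ∷ []) (_ ∷ _ ∷ _ ∷ _ ∷ []) r)

module _ {A : Set} where

  inserts : A → List A → List (List A)
  inserts a []      = (a ∷ []) ∷ []
  inserts a (b ∷ w) = (a ∷ b ∷ w) ∷ map (b ∷_) (inserts a w)

  permutations : List A → List (List A)
  permutations []      = [] ∷ []
  permutations (a ∷ w) = concatMap (inserts a) (permutations w)

  ∈-inserts : ∀ a us vs → us ++ a ∷ vs ∈ inserts a (us ++ vs)
  ∈-inserts a []       []      = here refl
  ∈-inserts a []       (_ ∷ _) = here refl
  ∈-inserts a (u ∷ us) vs      = there (∈-map⁺ (u ∷_) (∈-inserts a us vs))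

  ↭⇒∈-permutations : ∀ {v} w → v ↭ w → v ∈ permutations w
  ↭⇒∈-permutations []      v↭[] rewrite ↭-empty-inv v↭[] = here refl
  ↭⇒∈-permutations (a ∷ w) v↭a∷w with ∈-∃++ (∈-resp-↭ (↭-sym v↭a∷w) (here refl))
  ... | us , vs , refl =
    ∈-concat⁺′ (∈-inserts a us vs) (∈-map⁺ (inserts a) (↭⇒∈-permutations w (drop-mid us [] v↭a∷w)))

data Shape {A : Set} : List A → Set where
  aa     : ∀ a     → Shape (a ∷ a ∷ [])
  abab   : ∀ a b   → Shape (a ∷ b ∷ a ∷ b ∷ [])
  abacbc : ∀ a b c → Shape (a ∷ b ∷ a ∷ c ∷ b ∷ c ∷ [])
  abcacb : ∀ a b c → Shape (a ∷ b ∷ c ∷ a ∷ c ∷ b ∷ [])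
  abcbac : ∀ a b c → Shape (a ∷ b ∷ c ∷ b ∷ a ∷ c ∷ [])
  abcabc : ∀ a b c → Shape (a ∷ b ∷ c ∷ a ∷ b ∷ c ∷ [])

HasShapeFactor : {A : Set} → List A → Set
HasShapeFactor w = ∃[ q ] Shape q × Infix _≡_ q w

module _ {A : Set} (σ : A → ℕ) (σ>0 : ∀ a → 0 < σ a) where

  shape-unrealizable : ∀ {q} → Shape q → ¬ Realizable (map σ q)
  shape-unrealizable (aa a)         = stutter-unrealizable (σ>0 a)
  shape-unrealizable (abab a b)     = square-unrealizable (σ>0 a)
  shape-unrealizable (abacbc a b c) = abacbc-unrealizable (σ>0 a) (σ>0 b) (σ>0 c)
  shape-unrealizable (abcacb a b c) = abcacb-unrealizable (σ>0 a) (σ>0 b) (σ>0 c)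
  shape-unrealizable (abcbac a b c) = abcbac-unrealizable (σ>0 a) (σ>0 b) (σ>0 c)
  shape-unrealizable (abcabc a b c) = abcabc-unrealizable (σ>0 a) (σ>0 b) (σ>0 c)

  hasShapeFactor⇒unrealizable : ∀ {w} → HasShapeFactor w → ¬ Realizable (map σ w)
  hasShapeFactor⇒unrealizable (_ , shape , q⊆w) =
    shape-unrealizable shape ∘ realizable-infix (Infix.map⁺ σ σ (Infix.map (cong σ) q⊆w))

  permutations-unrealizable : ∀ w → All HasShapeFactor (permutations w) → ∀ p → p ↭ map σ w → ¬ Realizable p
  permutations-unrealizable w factors p p↭σw with ↭-map-inv σ (↭-sym p↭σw)
  ... | v , refl , w↭v = hasShapeFactor⇒unrealizable (All.lookup factors (↭⇒∈-permutations w (↭-sym w↭v)))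

module ShapeSearch {A : Set} (_≟_ : DecidableEquality A) where

  -- The shapes that may start a word, with their letters read off the word itself.
  shapesAt : List A → List (∃ Shape)
  shapesAt (a ∷ b ∷ c ∷ d ∷ _) =
    (-, aa a) ∷ (-, abab a b) ∷ (-, abacbc a b d) ∷ (-, abcacb a b c) ∷ (-, abcbac a b c) ∷ (-, abcabc a b c) ∷ []
  shapesAt (a ∷ _) = (-, aa a) ∷ []
  shapesAt []      = []

  shapePrefix? : List (∃ Shape) → (w : List A) → Maybe (HasShapeFactor w)
  shapePrefix? []                w = nothing
  shapePrefix? ((q , shape) ∷ qs) w with prefix? _≟_ q w
  ... | yes q⊑w = just (q , shape , here q⊑w)
  ... | no _    = shapePrefix? qs w

  shapeFactor? : (w : List A) → Maybe (HasShapeFactor w)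
  shapeFactor? []      = nothing
  shapeFactor? (a ∷ w) = shapePrefix? (shapesAt (a ∷ w)) (a ∷ w) <∣> Maybe.map (map₂ (map₂ there)) (shapeFactor? w)

  allShapeFactors? : (ws : List (List A)) → Maybe (All HasShapeFactor ws)
  allShapeFactors? []       = just []
  allShapeFactors? (w ∷ ws) with shapeFactor? w | allShapeFactors? ws
  ... | just f | just fs = just (f ∷ fs)
  ... | _      | _       = nothing

  permutationShapeFactors : ∀ w → From-just (allShapeFactors? (permutations w))
  permutationShapeFactors w = from-just (allShapeFactors? (permutations w))

open ShapeSearch (Fin._≟_ {3})

claim14 : (x y z : ℕ) → x > 0 → y > 0 → z > 0 →
          ((p : List ℕ) → p ↭ (x ∷ x ∷ []) → ¬ Realizable p)
          × ((p : List ℕ) → p ↭ (x ∷ x ∷ y ∷ y ∷ []) → ¬ Realizable p)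
          × ((p : List ℕ) → p ↭ (x ∷ x ∷ y ∷ y ∷ z ∷ z ∷ []) → ¬ Realizable p)
claim14 x y z x>0 y>0 z>0 =
    forbidden (a ∷ a ∷ [])                 (permutationShapeFactors (a ∷ a ∷ []))
  , forbidden (a ∷ a ∷ b ∷ b ∷ [])         (permutationShapeFactors (a ∷ a ∷ b ∷ b ∷ []))
  , forbidden (a ∷ a ∷ b ∷ b ∷ c ∷ c ∷ []) (permutationShapeFactors (a ∷ a ∷ b ∷ b ∷ c ∷ c ∷ []))
  where
  a b c : Fin 3
  a = zero
  b = suc zero
  c = suc (suc zero)
  σ : Fin 3 → ℕ
  σ zero             = x
  σ (suc zero)       = y
  σ (suc (suc zero)) = z
  σ>0 : ∀ i → 0 < σ i
  σ>0 zero             = x>0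
  σ>0 (suc zero)       = y>0
  σ>0 (suc (suc zero)) = z>0
  forbidden : ∀ w → All HasShapeFactor (permutations w) → ∀ p → p ↭ map σ w → ¬ Realizable p
  forbidden = permutations-unrealizable σ σ>0
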